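{- Let $n,k\ge1$, fix a whirling orbit board of $\mathcal{F}_k({\sf C}_n)$ decomposed into whorms, and let $\alpha=\alpha(f)$ for any $f$ in the orbit. If $\xi_1,\dots,\xi_{\alpha+1}$ are consecutive whorms ($\xi_{i+1}$ in front of $\xi_i$), then $t(\xi_1)+\cdots+t(\xi_{\alpha+1})=\alpha(k+2)$; equivalently, with $h(\xi)=k+2-t(\xi)$, $h(\xi_1)+\cdots+h(\xi_{\alpha+1})=k+2$, or $t(\xi_{\alpha+1})=h(\xi_1)+\cdots+h(\xi_\alpha)$.
   Context: ${\sf C}_n=\{b_1,\dots,b_n,\widehat0\}$ with $\widehat0<b_i$ and no other relations. $\mathcal{F}_k({\sf C}_n)$ is the set of $f:{\sf C}_n\to\{0,\dots,k\}$ with $f(b_i)\le f(\widehat0)$ for all $i$. The whirl $w_x$ repeatedly adds $1$ mod $k+1$ to $f(x)$ until the result lies in $\mathcal{F}_k({\sf C}_n)$; $w=w_{\widehat0}\circ w_{b_n}\circ\cdots\circ w_{b_1}$. $\alpha(f)=\#\{f(b_j):j\in[n]\}$ (constant along $w$-orbits). Orbit board of a $w$-orbit of size $N$: rows $f_0,\dots,f_{N-1}$ with $f_{t+1}=w(f_t)$, indices mod $N$. Whirl elements: pairs $(x,f_t)$. $(y,f_s)$ is whirl-successive to $(x,f_t)$ if (i) $y=x$, $s=t+1$, $f_s(x)=f_t(x)+1$ (as integers), or (ii) $x$ covers $y$, $s=t$, $f_t(x)=f_t(y)$. Whorms are the classes of the equivalence relation generated by whirl-successiveness. $t(\xi)=1+\min\{f_t(\widehat0):(\widehat0,f_t)\in\xi\}$.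 $\xi'$ is in front of $\xi$ if there is $t$ with $(\widehat0,f_t)\in\xi$, $f_t(\widehat0)=k$, $(\widehat0,f_{t+1})\in\xi'$. -}

module Defs where

open import Data.Nat using (ℕ; zero; suc; _+_; _*_; _≤_; _<_; _≤?_; _<?_)
open import Data.Nat.DivMod using (_%_)
open import Data.Fin using (Fin; toℕ; fromℕ<)
import Data.Fin as Fin
open import Data.Fin.Properties using (all?)
open import Data.List using (List; foldl; allFin; map; deduplicate; length)
open import Data.Product using (_×_; _,_; ∃; ∃-syntax; Σ)
open import Relation.Nullary using (Dec; yes; no; ¬_)
open import Relation.Nullary.Decidable using (_×-dec_)
open import Relation.Binary.PropositionalEquality using (_≡_)
open import Relation.Binary.Construct.Closure.Equivalence using (EqClosure)

-- The poset C_n = {b_1,…,b_n, 0̂} with 0̂ < b_i and no other relations.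
data Elt (n : ℕ) : Set where
  b   : Fin n → Elt n     -- b i  (i = 0 … n-1 stands for b_1 … b_n)
  bot : Elt n

data Covers {n : ℕ} : Elt n → Elt n → Set where
  b⋗bot : (i : Fin n) → Covers (b i) bot

Lab : ℕ → Set
Lab n = Elt n → ℕ

InF : ∀ {n} → ℕ → Lab n → Set
InF {n} k f = (f bot ≤ k) × ((i : Fin n) → f (b i) ≤ k) × ((i : Fin n) → f (b i) ≤ f bot)

inF? : ∀ {n} k (f : Lab n) → Dec (InF k f)
inF? k f = (f bot ≤? k) ×-dec (all? (λ i → f (b i) ≤? k) ×-dec all? (λ i → f (b i) ≤? f bot))

_≟E_ : ∀ {n} (x y : Elt n) → Dec (x ≡ y)
b i ≟E b j with i Fin.≟ j
... | yes Relation.Binary.PropositionalEquality.refl = yes Relation.Binary.PropositionalEquality.refl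
... | no ne = no λ { Relation.Binary.PropositionalEquality.refl → ne Relation.Binary.PropositionalEquality.refl }
b i ≟E bot = no λ ()
bot ≟E b j = no λ ()
bot ≟E bot = yes Relation.Binary.PropositionalEquality.refl

upd : ∀ {n} → Lab n → Elt n → ℕ → Lab n
upd f x v y with y ≟E x
... | yes _ = v
... | no  _ = f y

firstFit : ∀ {n} (k : ℕ) → Elt n → Lab n → ℕ → ℕ → Lab n
firstFit k x f j zero = f
firstFit k x f j (suc fuel) with inF? k (upd f x ((f x + j) % suc k))
... | yes _ = upd f x ((f x + j) % suc k)
... | no  _ = firstFit k x f (suc j) fuel

-- the whirl w_x: repeatedly add 1 mod k+1 to f(x) until the result lies in F_k
-- (at most k+1 additions are ever needed for f ∈ F_k)
whirlAt : ∀ {n} (k : ℕ) → Elt n → Lab n → Lab n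
whirlAt k x f = firstFit k x f 1 (suc k)

whirl : ∀ {n} (k : ℕ) → Lab n → Lab n
whirl {n} k f = whirlAt k bot (foldl (λ g i → whirlAt k (b i) g) f (allFin n))

whirlPow : ∀ {n} (k : ℕ) → ℕ → Lab n → Lab n
whirlPow k zero f = f
whirlPow k (suc t) f = whirl k (whirlPow k t f)

_≗L_ : ∀ {n} → Lab n → Lab n → Set
f ≗L g = ∀ x → f x ≡ g x

alpha : ∀ {n} → Lab n → ℕ
alpha {n} f = length (deduplicate Data.Nat._≟_ (map (λ j → f (b j)) (allFin n)))

IsOrbitSize : ∀ {n} (k : ℕ) → Lab n → ℕ → Set
IsOrbitSize k f0 N =
  (1 ≤ N) × (whirlPow k N f0 ≗L f0) × (∀ m → 1 ≤ m → m < N → ¬ (whirlPow k m f0 ≗L f0))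

row : ∀ {n N} (k : ℕ) → Lab n → Fin N → Lab n
row k f0 t = whirlPow k (toℕ t) f0

nextT : ∀ {N} → Fin N → Fin N
nextT {suc m} t with suc (toℕ t) <? suc m
... | yes p = fromℕ< p
... | no  _ = Fin.zero

WE : ℕ → ℕ → Set
WE n N = Elt n × Fin N

data Succ {n N} (k : ℕ) (f0 : Lab n) : WE n N → WE n N → Set where
  step  : (x : Elt n) (t : Fin N) →
          row k f0 (nextT t) x ≡ row k f0 t x + 1 →
          Succ k f0 (x , t) (x , nextT t)
  cover : (x y : Elt n) (t : Fin N) → Covers x y →
          row k f0 t x ≡ row k f0 t y →
          Succ k f0 (x , t) (y , t)

SameWhorm : ∀ {n N} (k : ℕ) (f0 : Lab n) → WE n N → WE n N → Set
SameWhorm k f0 = EqClosure (Succ k f0)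

-- a whorm is represented by any of its elements ξ; e ∈ ξ iff SameWhorm e ξ.
-- ξ' is in front of ξ
InFront : ∀ {n N} (k : ℕ) (f0 : Lab n) → WE n N → WE n N → Set
InFront {n} {N} k f0 ξ' ξ =
  ∃[ t ] (SameWhorm k f0 (bot , t) ξ × row k f0 t bot ≡ k × SameWhorm k f0 (bot , nextT t) ξ')

IsTval : ∀ {n N} (k : ℕ) (f0 : Lab n) → WE n N → ℕ → Set
IsTval {n} {N} k f0 ξ τ =
  Σ ℕ λ m → (τ ≡ 1 + m) ×
    (∃[ t ] (SameWhorm k f0 (bot , t) ξ × row k f0 t bot ≡ m)) ×
    (∀ (t : Fin N) → SameWhorm k f0 (bot , t) ξ → m ≤ row k f0 t bot)

-- Along an orbit the bottom label B_t climbs by one per step until it reaches k; the next whirl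
-- wraps it to the largest b-label, so some b_i then carries the bottom label and resets to 0 one
-- step later. Call a maximal climb a run: the run starting at T ends at T + (k − B_T), so the next
-- run starts at T′ = T + 1 + k − B_T, and (1 + B_T) + (T′ − T) = k + 2.
-- The phase t + (k − f_t(x)) mod N is constant on whorms. Hence the bottom elements of a whorm form
-- one run (modulo N), its least bottom label is the one at the run start, so t(ξ) = 1 + B_T, and
-- the whorm in front is the next run. Telescoping over the runs T_0, …, T_α leaves the claim
-- T_α = T_0 + t(ξ_{α+1}). Track a b_c that resets at T_0: it climbs by one per step, and at each
-- later run start exactly the topmost class of equal b-labels resets, so the number of distinct
-- b-labels above b_c drops by one per run; after α runs b_c is topmost, i.e. its label
-- T_α − T_0 − 1 is the bottom label.

{-# OPTIONS --safe #-}
module Submission where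

open import Defs
open import Data.Nat using (ℕ; zero; suc; _+_; _*_; _∸_; _≤_; _<_; _≤?_; _<?_; _≟_; z≤n; s≤s; s≤s⁻¹; NonZero)
open import Data.Nat.ListAction using (sum)
open import Data.Nat.Properties
open import Data.Nat.DivMod using (_%_; _/_; [m+n]%n≡m%n; m≤n⇒m%n≡m; m<n⇒m%n≡m; n%n≡0; m≡m%n+[m/n]*n)
open import Data.Fin as Fin using (Fin; toℕ; inject₁)
import Data.Fin.Properties as Finₚ
open import Data.Fin.Induction using (<-weakInduction)
open import Data.List using (List; []; _∷_; foldl; allFin; tabulate; map; length; deduplicate)
open import Data.List.Relation.Unary.All as All using (All; _∷_)
open import Data.List.Relation.Unary.All.Properties using (All¬⇒¬Any)
open import Data.List.Relation.Unary.Any using (here; there)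
open import Data.List.Membership.Propositional using (_∈_; _∉_)
open import Data.List.Membership.Propositional.Properties using (∈-allFin; ∈-map⁺; ∈-map⁻; ∈-deduplicate⁺; ∈-deduplicate⁻)
open import Data.List.Membership.DecPropositional _≟_ using (_∈?_)
open import Data.List.Relation.Unary.Unique.DecPropositional.Properties using (deduplicate-!)
open import Data.List.Relation.Unary.AllPairs using (_∷_)
open import Data.List.Relation.Unary.Unique.Propositional using (Unique)
open import Data.List.Relation.Unary.Unique.Propositional.Properties using (allFin⁺)
import Data.List.Extrema ≤-totalOrder as Extrema
open import Data.Nat.Tactic.RingSolver using (solve-∀)
open import Relation.Binary.Construct.Closure.ReflexiveTransitive using (ε; _◅_)
open import Relation.Binary.Construct.Closure.Symmetric using (fwd; bwd)
open import Data.Product using (_×_; _,_; ∃-syntax; proj₁; proj₂)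
open import Data.Sum using (_⊎_; inj₁; inj₂)
open import Data.Empty using (⊥-elim)
open import Function using (_∘_; case_of_)
open import Relation.Nullary using (Dec; yes; no; ¬_)
open import Relation.Binary.PropositionalEquality using (_≡_; _≢_; refl; sym; trans; cong; cong₂; subst; subst₂; module ≡-Reasoning)

private variable
  n : ℕ

-- Single whirls

upd-≡ : (f : Lab n) (x : Elt n) (v : ℕ) → upd f x v x ≡ v
upd-≡ f x v with x ≟E x
... | yes _ = refl
... | no x≢x = ⊥-elim (x≢x refl)

upd-≢ : (f : Lab n) (x : Elt n) (v : ℕ) {y : Elt n} → y ≢ x → upd f x v y ≡ f y
upd-≢ f x v {y} y≢x with y ≟E x
... | yes y≡x = ⊥-elim (y≢x y≡x)
... | no _ = refl

upd-cong : {f h : Lab n} (x : Elt n) {v w : ℕ} → f ≗L h → v ≡ w → upd f x v ≗L upd h x w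
upd-cong x f≗h refl y with y ≟E x
... | yes _ = refl
... | no _ = f≗h y

InF-cong : ∀ k {f h : Lab n} → f ≗L h → InF k f → InF k h
InF-cong k f≗h (bot≤k , b≤k , b≤bot) =
  subst (_≤ k) (f≗h bot) bot≤k ,
  (λ i → subst (_≤ k) (f≗h (b i)) (b≤k i)) ,
  (λ i → subst₂ _≤_ (f≗h (b i)) (f≗h bot) (b≤bot i))

InF-upd-b : ∀ {k} {f : Lab n} i {v} → InF k f → v ≤ f bot → InF k (upd f (b i) v)
InF-upd-b {k = k} {f} i {v} (bot≤k , _ , b≤bot) v≤bot = bot≤k , (λ j → ≤-trans (b≤bot′ j) bot≤k) , b≤bot′
  where
  b≤bot′ : ∀ j → upd f (b i) v (b j) ≤ f bot
  b≤bot′ j with b j ≟E b i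
  ... | yes _ = v≤bot
  ... | no _ = b≤bot j

InF-upd-bot : ∀ {k} {f : Lab n} {v} → (∀ i → f (b i) ≤ k) → v ≤ k → (∀ i → f (b i) ≤ v) → InF k (upd f bot v)
InF-upd-bot {f = f} {v} b≤k v≤k b≤v =
  subst (_≤ _) (sym (upd-≡ f bot v)) v≤k ,
  (λ i → subst (_≤ _) (sym (upd-≢ f bot v λ ())) (b≤k i)) ,
  (λ i → subst₂ _≤_ (sym (upd-≢ f bot v λ ())) (sym (upd-≡ f bot v)) (b≤v i))

candidate : ℕ → Elt n → Lab n → ℕ → Lab n
candidate k x f j = upd f x ((f x + j) % suc k)

Fits : ℕ → Elt n → Lab n → ℕ → Set
Fits k x f j = InF k (candidate k x f j)

firstFit-InF : ∀ k x {f : Lab n} j fuel → InF k f → InF k (firstFit k x f j fuel)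
firstFit-InF k x j zero F = F
firstFit-InF k x {f} j (suc fuel) F with inF? k (upd f x ((f x + j) % suc k))
... | yes fits = fits
... | no _ = firstFit-InF k x (suc j) fuel F

firstFit-≢ : ∀ k x (f : Lab n) j fuel {y} → y ≢ x → firstFit k x f j fuel y ≡ f y
firstFit-≢ k x f j zero y≢x = refl
firstFit-≢ k x f j (suc fuel) y≢x with inF? k (upd f x ((f x + j) % suc k))
... | yes _ = upd-≢ f x _ y≢x
... | no _ = firstFit-≢ k x f (suc j) fuel y≢x

candidate-cong : ∀ k x {f h : Lab n} j → f ≗L h → candidate k x f j ≗L candidate k x h j
candidate-cong k x j f≗h = upd-cong x f≗h (cong (λ u → (u + j) % suc k) (f≗h x))

firstFit-cong : ∀ k x {f h : Lab n} j fuel → f ≗L h → firstFit k x f j fuel ≗L firstFit k x h j fuel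
firstFit-cong k x j zero f≗h = f≗h
firstFit-cong k x {f} {h} j (suc fuel) f≗h
  with inF? k (upd f x ((f x + j) % suc k)) | inF? k (upd h x ((h x + j) % suc k))
... | yes _ | yes _ = candidate-cong k x j f≗h
... | yes fits | no ¬fits = ⊥-elim (¬fits (InF-cong k (candidate-cong k x j f≗h) fits))
... | no ¬fits | yes fits = ⊥-elim (¬fits (InF-cong k (λ y → sym (candidate-cong k x j f≗h y)) fits))
... | no _ | no _ = firstFit-cong k x (suc j) fuel f≗h

firstFit-first : ∀ k x (f : Lab n) {j J} fuel → j ≤ J → J < j + fuel →
  (∀ i → j ≤ i → i < J → ¬ Fits k x f i) → Fits k x f J →
  firstFit k x f j fuel ≡ candidate k x f J
firstFit-first k x f {j} zero j≤J J<j+0 _ _ = ⊥-elim (<⇒≱ J<j+0 (subst (_≤ _) (sym (+-identityʳ j)) j≤J))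
firstFit-first k x f {j} {J} (suc fuel) j≤J J<j+fuel earlier fitsJ
  with inF? k (upd f x ((f x + j) % suc k)) | m≤n⇒m<n∨m≡n j≤J
... | yes fits | inj₁ j<J = ⊥-elim (earlier j ≤-refl j<J fits)
... | yes _ | inj₂ refl = refl
... | no ¬fits | inj₂ refl = ⊥-elim (¬fits fitsJ)
... | no _ | inj₁ j<J =
  firstFit-first k x f fuel j<J (subst (J <_) (+-suc j fuel) J<j+fuel) (λ i j<i → earlier i (<⇒≤ j<i)) fitsJ

whirlAt-first : ∀ k x (f : Lab n) J → 1 ≤ J → J ≤ suc k →
  (∀ i → 1 ≤ i → i < J → ¬ Fits k x f i) → Fits k x f J →
  whirlAt k x f ≡ candidate k x f J
whirlAt-first k x f J 1≤J J≤1+k = firstFit-first k x f (suc k) 1≤J (s≤s J≤1+k)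

whirlAt-first-1 : ∀ k x (f : Lab n) → Fits k x f 1 → whirlAt k x f ≡ candidate k x f 1
whirlAt-first-1 k x f = whirlAt-first k x f 1 ≤-refl (s≤s z≤n) λ j 1≤j j<1 → ⊥-elim (<⇒≱ j<1 1≤j)

bStep : ℕ → ℕ → ℕ
bStep B u with u <? B
... | yes _ = suc u
... | no _ = 0

bStep-< : ∀ {B u} → u < B → bStep B u ≡ suc u
bStep-< {B} {u} u<B with u <? B
... | yes _ = refl
... | no u≮B = ⊥-elim (u≮B u<B)

bStep-≮ : ∀ {B u} → ¬ u < B → bStep B u ≡ 0
bStep-≮ {B} {u} u≮B with u <? B
... | yes u<B = ⊥-elim (u≮B u<B)
... | no _ = refl

bStep-≤ : ∀ B u → bStep B u ≤ B
bStep-≤ B u with u <? B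
... | yes u<B = u<B
... | no _ = z≤n

whirlAt-b : ∀ k (f : Lab n) i → InF k f → whirlAt k (b i) f ≡ upd f (b i) (bStep (f bot) (f (b i)))
whirlAt-b k f i F@(bot≤k , b≤k , b≤bot) with f (b i) <? f bot
... | yes u<B = begin
  whirlAt k (b i) f                      ≡⟨ whirlAt-first-1 k (b i) f fits ⟩
  upd f (b i) ((f (b i) + 1) % suc k)    ≡⟨ cong (upd f (b i)) value ⟩
  upd f (b i) (suc (f (b i)))            ∎
  where
  open ≡-Reasoning
  value : (f (b i) + 1) % suc k ≡ suc (f (b i))
  value = trans (cong (_% suc k) (+-comm (f (b i)) 1)) (m<n⇒m%n≡m (s≤s (≤-trans u<B bot≤k)))
  fits : Fits k (b i) f 1
  fits = subst (λ v → InF k (upd f (b i) v)) (sym value) (InF-upd-b i F u<B)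
... | no u≮B = begin
  whirlAt k (b i) f                      ≡⟨ whirlAt-first k (b i) f J 1≤J (m∸n≤m (suc k) u) overshoot fits ⟩
  upd f (b i) ((u + J) % suc k)          ≡⟨ cong (upd f (b i)) value ⟩
  upd f (b i) 0                          ∎
  where
  open ≡-Reasoning
  u = f (b i)
  u≡B : u ≡ f bot
  u≡B = ≤-antisym (b≤bot i) (≮⇒≥ u≮B)
  J = suc k ∸ u
  1≤J : 1 ≤ J
  1≤J = subst (1 ≤_) (sym (+-∸-assoc 1 (b≤k i))) (s≤s z≤n)
  value : (u + J) % suc k ≡ 0
  value = trans (cong (_% suc k) (m+[n∸m]≡n (≤-trans (b≤k i) (n≤1+n k)))) (n%n≡0 (suc k))
  fits : Fits k (b i) f J
  fits = subst (λ v → InF k (upd f (b i) v)) (sym value) (InF-upd-b i F z≤n)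
  overshoot : ∀ j → 1 ≤ j → j < J → ¬ Fits k (b i) f j
  overshoot j 1≤j j<J (_ , _ , b≤bot′) = <⇒≱ B<u+j u+j≤B
    where
    u+j<1+k : u + j < suc k
    u+j<1+k = subst (u + j <_) (m+[n∸m]≡n (≤-trans (b≤k i) (n≤1+n k))) (+-monoʳ-< u j<J)
    u+j≤B : u + j ≤ f bot
    u+j≤B = subst (_≤ f bot) (trans (upd-≡ f (b i) _) (m<n⇒m%n≡m u+j<1+k)) (b≤bot′ i)
    B<u+j : f bot < u + j
    B<u+j = subst (_< u + j) u≡B (subst (_≤ u + j) (+-comm u 1) (+-monoʳ-≤ u 1≤j))

-- The whirl w

sweep : ℕ → Lab n → List (Fin n) → Lab n
sweep k f L = foldl (λ g i → whirlAt k (b i) g) f L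

sweep-InF : ∀ k {f : Lab n} L → InF k f → InF k (sweep k f L)
sweep-InF k [] F = F
sweep-InF k {f} (i ∷ L) F = sweep-InF k L (firstFit-InF k (b i) {f} 1 (suc k) F)

sweep-bot : ∀ k (f : Lab n) L → sweep k f L bot ≡ f bot
sweep-bot k f [] = refl
sweep-bot k f (i ∷ L) = trans (sweep-bot k (whirlAt k (b i) f) L) (firstFit-≢ k (b i) f 1 (suc k) λ ())

sweep-∉ : ∀ k (f : Lab n) {L i} → i ∉ L → sweep k f L (b i) ≡ f (b i)
sweep-∉ k f {[]} i∉L = refl
sweep-∉ k f {j ∷ L} {i} i∉L =
  trans (sweep-∉ k (whirlAt k (b j) f) (i∉L ∘ there)) (firstFit-≢ k (b j) f 1 (suc k) λ { refl → i∉L (here refl) })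

sweep-∈ : ∀ k {f : Lab n} {L i} → InF k f → Unique L → i ∈ L → sweep k f L (b i) ≡ bStep (f bot) (f (b i))
sweep-∈ k {f} {j ∷ L} F (j∉L ∷ _) (here refl) = begin
  sweep k (whirlAt k (b j) f) L (b j)   ≡⟨ sweep-∉ k _ (All¬⇒¬Any j∉L) ⟩
  whirlAt k (b j) f (b j)               ≡⟨ cong (λ g → g (b j)) (whirlAt-b k f j F) ⟩
  upd f (b j) _ (b j)                   ≡⟨ upd-≡ f (b j) _ ⟩
  bStep (f bot) (f (b j))               ∎
  where open ≡-Reasoning
sweep-∈ k {f} {j ∷ L} {i} F (j∉L ∷ unique) (there i∈L) =
  trans (sweep-∈ k (firstFit-InF k (b j) {f} 1 (suc k) F) unique i∈L)
        (cong₂ bStep (firstFit-≢ k (b j) f 1 (suc k) λ ())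
                     (firstFit-≢ k (b j) f 1 (suc k) λ { refl → All.lookup j∉L i∈L refl }))

sweep-cong : ∀ k {f h : Lab n} L → f ≗L h → sweep k f L ≗L sweep k h L
sweep-cong k [] f≗h = f≗h
sweep-cong k (i ∷ L) f≗h = sweep-cong k L (firstFit-cong k (b i) 1 (suc k) f≗h)

whirl-cong : ∀ k {f h : Lab n} → f ≗L h → whirl k f ≗L whirl k h
whirl-cong {n} k f≗h = firstFit-cong k bot 1 (suc k) (sweep-cong k (allFin n) f≗h)

whirl-InF : ∀ k {f : Lab n} → InF k f → InF k (whirl k f)
whirl-InF {n} k {f} F = firstFit-InF k bot {sweep k f (allFin n)} 1 (suc k) (sweep-InF k (allFin n) F)

whirl-b : ∀ k {f : Lab n} i → InF k f → whirl k f (b i) ≡ bStep (f bot) (f (b i))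
whirl-b {n} k {f} i F =
  trans (firstFit-≢ k bot (sweep k f (allFin n)) 1 (suc k) λ ()) (sweep-∈ k F (allFin⁺ n) (∈-allFin i))

whirl-bot-< : ∀ k {f : Lab n} → InF k f → f bot < k → whirl k f bot ≡ suc (f bot)
whirl-bot-< {n} k {f} F B<k = begin
  whirl k f bot       ≡⟨ cong (λ g → g bot) (whirlAt-first-1 k bot f′ fits) ⟩
  upd f′ bot v bot    ≡⟨ upd-≡ f′ bot v ⟩
  v                   ≡⟨ value ⟩
  suc (f bot)         ∎
  where
  open ≡-Reasoning
  f′ = sweep k f (allFin n)
  F′ = sweep-InF k {f} (allFin n) F
  v = (f′ bot + 1) % suc k
  value : v ≡ suc (f bot)
  value = trans (cong (λ u → (u + 1) % suc k) (sweep-bot k f (allFin _)))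
                (trans (cong (_% suc k) (+-comm (f bot) 1)) (m<n⇒m%n≡m (s≤s B<k)))
  b≤1+B : ∀ i → f′ (b i) ≤ suc (f bot)
  b≤1+B i = ≤-trans (proj₂ (proj₂ F′) i) (≤-trans (≤-reflexive (sweep-bot k f (allFin _))) (n≤1+n _))
  fits : Fits k bot f′ 1
  fits = subst (λ w → InF k (upd f′ bot w)) (sym value) (InF-upd-bot {f = f′} (proj₁ (proj₂ F′)) B<k b≤1+B)

IsBValue : Lab n → ℕ → Set
IsBValue f v = ∃[ i ] f (b i) ≡ v

bot-IsBValue-cong : {f h : Lab n} → f ≗L h → IsBValue f (f bot) → IsBValue h (h bot)
bot-IsBValue-cong f≗h (i , e) = i , trans (sym (f≗h (b i))) (trans e (f≗h bot))

wrap-mod : ∀ {k j} → j ≤ k → (k + suc j) % suc k ≡ j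
wrap-mod {k} {j} j≤k = begin
  (k + suc j) % suc k  ≡⟨ cong (_% suc k) (trans (+-comm k (suc j)) (sym (+-suc j k))) ⟩
  (j + suc k) % suc k  ≡⟨ [m+n]%n≡m%n j (suc k) ⟩
  j % suc k            ≡⟨ m≤n⇒m%n≡m j≤k ⟩
  j                    ∎
  where open ≡-Reasoning

whirl-bot-k : ∀ {m} k {f : Lab (suc m)} → InF k f → f bot ≡ k → IsBValue (whirl k f) (whirl k f bot)
whirl-bot-k {m} k {f} F B≡k =
  i₀ , trans (cong (λ g → g (b i₀)) whirl≡) (sym (trans (cong (λ g → g bot) whirl≡) (upd-≡ f′ bot M)))
  where
  f′ = sweep k f (allFin (suc m))
  b≤k = proj₁ (proj₂ (sweep-InF k {f} (allFin (suc m)) F))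
  i₀ = Extrema.argmax (λ i → f′ (b i)) Fin.zero (allFin (suc m))
  M = f′ (b i₀)
  b≤M : ∀ i → f′ (b i) ≤ M
  b≤M i = All.lookup (Extrema.f[xs]≤f[argmax] {f = λ i → f′ (b i)} Fin.zero (allFin (suc m))) (∈-allFin i)
  value : ∀ {j} → j ≤ k → (f′ bot + suc j) % suc k ≡ j
  value {j} j≤k = trans (cong (λ u → (u + suc j) % suc k) (trans (sweep-bot k f (allFin _)) B≡k)) (wrap-mod j≤k)
  fits : Fits k bot f′ (suc M)
  fits = subst (λ w → InF k (upd f′ bot w)) (sym (value (b≤k i₀))) (InF-upd-bot {f = f′} b≤k (b≤k i₀) b≤M)
  below : ∀ j → 1 ≤ j → j < suc M → ¬ Fits k bot f′ j
  below (suc j) _ (s≤s j<M) (_ , _ , b≤new) =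
    <⇒≱ j<M (subst (M ≤_) (trans (upd-≡ f′ bot _) (value (≤-trans (<⇒≤ j<M) (b≤k i₀)))) (b≤new i₀))
  whirl≡ : whirl k f ≡ upd f′ bot M
  whirl≡ = trans (whirlAt-first k bot f′ (suc M) (s≤s z≤n) (s≤s (b≤k i₀)) below fits)
                 (cong (upd f′ bot) (value (b≤k i₀)))

-- Sums over ranges and distinct b-labels

rangeSum : (ℕ → ℕ) → ℕ → ℕ → ℕ
rangeSum ι lo zero = 0
rangeSum ι lo (suc len) = ι lo + rangeSum ι (suc lo) len

rangeSum-cong : ∀ {ι κ} lo len → (∀ v → lo ≤ v → ι v ≡ κ v) → rangeSum ι lo len ≡ rangeSum κ lo len
rangeSum-cong lo zero ι≗κ = refl
rangeSum-cong lo (suc len) ι≗κ = cong₂ _+_ (ι≗κ lo ≤-refl) (rangeSum-cong (suc lo) len λ v lo<v → ι≗κ v (<⇒≤ lo<v))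

rangeSum-zero : ∀ {ι} lo len → (∀ v → lo ≤ v → ι v ≡ 0) → rangeSum ι lo len ≡ 0
rangeSum-zero lo zero ι≡0 = refl
rangeSum-zero lo (suc len) ι≡0 = cong₂ _+_ (ι≡0 lo ≤-refl) (rangeSum-zero (suc lo) len λ v lo<v → ι≡0 v (<⇒≤ lo<v))

rangeSum-shift : ∀ ι lo len → rangeSum (ι ∘ suc) lo len ≡ rangeSum ι (suc lo) len
rangeSum-shift ι lo zero = refl
rangeSum-shift ι lo (suc len) = cong (ι (suc lo) +_) (rangeSum-shift ι (suc lo) len)

rangeSum-snoc : ∀ ι lo len → rangeSum ι lo (suc len) ≡ rangeSum ι lo len + ι (lo + len)
rangeSum-snoc ι lo zero = trans (+-identityʳ (ι lo)) (cong ι (sym (+-identityʳ lo)))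
rangeSum-snoc ι lo (suc len) = begin
  ι lo + rangeSum ι (suc lo) (suc len)                 ≡⟨ cong (ι lo +_) (rangeSum-snoc ι (suc lo) len) ⟩
  ι lo + (rangeSum ι (suc lo) len + ι (suc lo + len))  ≡⟨ sym (+-assoc (ι lo) _ _) ⟩
  ι lo + rangeSum ι (suc lo) len + ι (suc lo + len)    ≡⟨ cong (λ v → ι lo + rangeSum ι (suc lo) len + ι v) (sym (+-suc lo len)) ⟩
  ι lo + rangeSum ι (suc lo) len + ι (lo + suc len)    ∎
  where open ≡-Reasoning

rangeSum-extract : ∀ {ι κ} lo len {p} → lo ≤ p → p < lo + len →
  (∀ v → v ≢ p → ι v ≡ κ v) → κ p ≡ 0 → rangeSum ι lo len ≡ rangeSum κ lo len + ι p
rangeSum-extract lo zero lo≤p p<lo+0 _ _ = ⊥-elim (<⇒≱ p<lo+0 (subst (_≤ _) (sym (+-identityʳ lo)) lo≤p))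
rangeSum-extract {ι} {κ} lo (suc len) {p} lo≤p p<lo+len ι≗κ κp≡0 with lo ≟ p
... | yes refl = begin
  ι lo + rangeSum ι (suc lo) len        ≡⟨ +-comm (ι lo) _ ⟩
  rangeSum ι (suc lo) len + ι lo        ≡⟨ cong (_+ ι lo) (rangeSum-cong (suc lo) len λ v lo<v → ι≗κ v (>⇒≢ lo<v)) ⟩
  rangeSum κ (suc lo) len + ι lo        ≡⟨ cong (λ z → z + rangeSum κ (suc lo) len + ι lo) (sym κp≡0) ⟩
  κ lo + rangeSum κ (suc lo) len + ι lo ∎
  where open ≡-Reasoning
... | no lo≢p = begin
  ι lo + rangeSum ι (suc lo) len          ≡⟨ cong₂ _+_ (ι≗κ lo lo≢p) rest ⟩
  κ lo + (rangeSum κ (suc lo) len + ι p)  ≡⟨ sym (+-assoc (κ lo) _ _) ⟩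
  κ lo + rangeSum κ (suc lo) len + ι p    ∎
  where
  open ≡-Reasoning
  rest : rangeSum ι (suc lo) len ≡ rangeSum κ (suc lo) len + ι p
  rest = rangeSum-extract (suc lo) len (≤∧≢⇒< lo≤p lo≢p) (subst (p <_) (+-suc lo len) p<lo+len) ι≗κ κp≡0

sum-tabulate : ∀ {L} (τ : Fin L → ℕ) ι lo → (∀ i → τ i ≡ ι (lo + toℕ i)) → sum (tabulate τ) ≡ rangeSum ι lo L
sum-tabulate {zero} τ ι lo τ≡ι = refl
sum-tabulate {suc L} τ ι lo τ≡ι = cong₂ _+_ (trans (τ≡ι Fin.zero) (cong ι (+-identityʳ lo)))
  (sum-tabulate (τ ∘ Fin.suc) ι (suc lo) λ i → trans (τ≡ι (Fin.suc i)) (cong ι (+-suc lo (toℕ i))))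

indicator : ∀ {P : Set} → Dec P → ℕ
indicator (yes _) = 1
indicator (no _) = 0

indicator-yes : ∀ {P : Set} (d : Dec P) → P → indicator d ≡ 1
indicator-yes (yes _) _ = refl
indicator-yes (no ¬p) p = ⊥-elim (¬p p)

indicator-no : ∀ {P : Set} (d : Dec P) → ¬ P → indicator d ≡ 0
indicator-no (yes p) ¬p = ⊥-elim (¬p p)
indicator-no (no _) _ = refl

indicator-⇔ : ∀ {P Q : Set} (d : Dec P) (e : Dec Q) → (P → Q) → (Q → P) → indicator d ≡ indicator e
indicator-⇔ (yes p) e to from = sym (indicator-yes e (to p))
indicator-⇔ (no ¬p) e to from = sym (indicator-no e (¬p ∘ from))

χ : Lab n → ℕ → ℕ
χ f v = indicator (Finₚ.any? λ i → f (b i) ≟ v)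

χ-yes : (f : Lab n) {v : ℕ} → IsBValue f v → χ f v ≡ 1
χ-yes f = indicator-yes _

χ-no : (f : Lab n) {v : ℕ} → ¬ IsBValue f v → χ f v ≡ 0
χ-no f = indicator-no _

-- All labels are at most k, so above k f x counts the distinct b-labels larger than x, and
-- distinct k f all distinct b-labels; its range is chosen so that distinct k f ≡ χ f 0 + above k f 0
-- holds by definition.
above : ℕ → Lab n → ℕ → ℕ
above k f x = rangeSum (χ f) (suc x) (suc k)

distinct : ℕ → Lab n → ℕ
distinct k f = rangeSum (χ f) 0 (suc (suc k))

length-unique : ∀ L {ys : List ℕ} → Unique ys → All (_< L) ys → length ys ≡ rangeSum (λ v → indicator (v ∈? ys)) 0 L
length-unique L {[]} _ _ = sym (rangeSum-zero 0 L λ v _ → refl)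
length-unique L {y ∷ ys} (y∉ys ∷ unique) (y<L ∷ ys<L) = begin
  suc (length ys)                               ≡⟨ cong suc (length-unique L unique ys<L) ⟩
  suc (rangeSum (λ v → indicator (v ∈? ys)) 0 L) ≡⟨ +-comm 1 _ ⟩
  rangeSum (λ v → indicator (v ∈? ys)) 0 L + 1   ≡⟨ cong (_ +_) (sym (indicator-yes (y ∈? y ∷ ys) (here refl))) ⟩
  rangeSum (λ v → indicator (v ∈? ys)) 0 L + indicator (y ∈? y ∷ ys)
    ≡⟨ sym (rangeSum-extract 0 L z≤n y<L elsewhere (indicator-no (y ∈? ys) (All¬⇒¬Any y∉ys))) ⟩
  rangeSum (λ v → indicator (v ∈? y ∷ ys)) 0 L   ∎
  where
  open ≡-Reasoning
  elsewhere : ∀ v → v ≢ y → indicator (v ∈? y ∷ ys) ≡ indicator (v ∈? ys)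
  elsewhere v v≢y = indicator-⇔ (v ∈? y ∷ ys) (v ∈? ys)
    (λ { (here v≡y) → ⊥-elim (v≢y v≡y) ; (there v∈ys) → v∈ys }) there

alpha≡distinct : ∀ k (f : Lab n) → (∀ i → f (b i) ≤ k) → alpha f ≡ distinct k f
alpha≡distinct {n} k f b≤k = begin
  length (deduplicate _≟_ values)    ≡⟨ length-unique _ (deduplicate-! _≟_ values) values<2+k ⟩
  rangeSum memberOf 0 (suc (suc k))
    ≡⟨ rangeSum-cong {ι = memberOf} {κ = χ f} 0 (suc (suc k)) (λ v _ → indicator-⇔ _ _ to from) ⟩
  distinct k f                       ∎
  where
  open ≡-Reasoning
  values = map (λ i → f (b i)) (allFin n)
  memberOf : ℕ → ℕ
  memberOf v = indicator (v ∈? deduplicate _≟_ values)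
  to : ∀ {v} → v ∈ deduplicate _≟_ values → IsBValue f v
  to v∈ with ∈-map⁻ (λ i → f (b i)) (∈-deduplicate⁻ _≟_ values v∈)
  ... | i , _ , v≡fbi = i , sym v≡fbi
  from : ∀ {v} → IsBValue f v → v ∈ deduplicate _≟_ values
  from (i , refl) = ∈-deduplicate⁺ _≟_ (∈-map⁺ (λ i → f (b i)) (∈-allFin i))
  values<2+k : All (_< suc (suc k)) (deduplicate _≟_ values)
  values<2+k = All.tabulate λ v∈ → case to v∈ of λ { (i , refl) → ≤-trans (s≤s (b≤k i)) (n≤1+n _) }

bStep-≡suc : ∀ {B u v} → bStep B u ≡ suc v → u ≡ v
bStep-≡suc {B} {u} e with u <? B
... | yes _ = suc-injective e
... | no _ = ⊥-elim (0≢1+n e)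

bStep-≡0 : ∀ {B u} → u ≤ B → bStep B u ≡ 0 → u ≡ B
bStep-≡0 {B} {u} u≤B e with u <? B
... | yes _ = ⊥-elim (1+n≢0 e)
... | no u≮B = ≤-antisym u≤B (≮⇒≥ u≮B)

above-none : ∀ k (f : Lab n) x → (∀ i → f (b i) ≤ x) → above k f x ≡ 0
above-none k f x b≤x = rangeSum-zero (suc x) (suc k) λ v x<v → χ-no f λ (i , fbi≡v) → <⇒≱ x<v (subst (_≤ x) fbi≡v (b≤x i))

module _ {f f′ : Lab n} (b≤B : ∀ i → f (b i) ≤ f bot) (f′-b : ∀ i → f′ (b i) ≡ bStep (f bot) (f (b i))) where

  χ-step-suc : ∀ {v} → v ≢ f bot → χ f′ (suc v) ≡ χ f v
  χ-step-suc {v} v≢B = indicator-⇔ _ _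
    (λ (i , e) → i , bStep-≡suc (trans (sym (f′-b i)) e))
    (λ (i , e) → i , trans (f′-b i) (trans (bStep-< (≤∧≢⇒< (b≤B i) (v≢B ∘ trans (sym e)))) (cong suc e)))

  χ-step-0 : χ f′ 0 ≡ χ f (f bot)
  χ-step-0 = indicator-⇔ _ _
    (λ (i , e) → i , bStep-≡0 (b≤B i) (trans (sym (f′-b i)) e))
    (λ (i , e) → i , trans (f′-b i) (bStep-≮ (<-irrefl e)))

  χ-step-beyond : ∀ {v} → f bot < v → χ f′ v ≡ 0
  χ-step-beyond B<v = χ-no f′ λ (i , e) → <⇒≱ B<v (subst (_≤ _) (trans (sym (f′-b i)) e) (bStep-≤ _ _))

  rangeSum-χ-step : ∀ lo len → lo ≤ f bot → f bot < lo + len →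
    rangeSum (χ f) lo len ≡ rangeSum (χ f′) (suc lo) len + χ f (f bot)
  rangeSum-χ-step lo len lo≤B B<lo+len =
    trans (rangeSum-extract {κ = χ f′ ∘ suc} lo len lo≤B B<lo+len (λ v v≢B → sym (χ-step-suc v≢B))
                            (χ-step-beyond ≤-refl))
          (cong (_+ χ f (f bot)) (rangeSum-shift (χ f′) lo len))

  above-step : ∀ {k x} → f bot ≤ k → x < f bot → above k f x ≡ above k f′ (suc x) + χ f (f bot)
  above-step {k} {x} B≤k x<B = rangeSum-χ-step (suc x) (suc k) x<B (≤-trans (s≤s B≤k) (m≤n+m (suc k) (suc x)))

  distinct-step : ∀ {k} → f bot ≤ k → distinct k f′ ≡ distinct k f
  distinct-step {k} B≤k = begin
    χ f′ 0 + R                                   ≡⟨ cong (_+ R) χ-step-0 ⟩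
    χ f (f bot) + R                              ≡⟨ +-comm _ R ⟩
    R + χ f (f bot)                              ≡⟨ cong (_+ χ f (f bot)) (sym R≡) ⟩
    rangeSum (χ f′) 1 (suc (suc k)) + χ f (f bot) ≡⟨ sym (rangeSum-χ-step 0 (suc (suc k)) z≤n (s≤s (≤-trans B≤k (n≤1+n k)))) ⟩
    distinct k f                                 ∎
    where
    open ≡-Reasoning
    R = rangeSum (χ f′) 1 (suc k)
    R≡ : rangeSum (χ f′) 1 (suc (suc k)) ≡ R
    R≡ = trans (rangeSum-snoc (χ f′) 1 (suc k))
               (trans (cong (R +_) (χ-step-beyond (s≤s (≤-trans B≤k (n≤1+n k))))) (+-identityʳ R))

-- Time modulo the period

%-injective-window : ∀ N .{{_ : NonZero N}} {a c} → c ≤ a → a < c + N → a % N ≡ c % N → a ≡ c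
%-injective-window N {a} {c} c≤a a<c+N a%N≡c%N = ≤-antisym a≤c c≤a
  where
  r = c % N
  a≡ : a ≡ r + (a / N) * N
  a≡ = trans (m≡m%n+[m/n]*n a N) (cong (_+ (a / N) * N) a%N≡c%N)
  c≡ : c ≡ r + (c / N) * N
  c≡ = m≡m%n+[m/n]*n c N
  a/N<1+c/N : a / N < suc (c / N)
  a/N<1+c/N = *-cancelʳ-< N (a / N) (suc (c / N)) (+-cancelˡ-< r _ _ (subst₂ _<_ a≡ c+N≡ a<c+N))
    where
    c+N≡ : c + N ≡ r + suc (c / N) * N
    c+N≡ = trans (cong (_+ N) c≡) (trans (+-assoc r _ N) (cong (r +_) (+-comm ((c / N) * N) N)))
  a≤c : a ≤ c
  a≤c = subst₂ _≤_ (sym a≡) (sym c≡) (+-monoʳ-≤ r (*-monoˡ-≤ N (s≤s⁻¹ a/N<1+c/N)))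

+-≡-≤-≤ : ∀ {m n o p} → m + n ≡ o + p → o ≤ m → p ≤ n → m ≡ o
+-≡-≤-≤ {m} {n} {o} {p} m+n≡o+p o≤m p≤n =
  ≤-antisym (+-cancelʳ-≤ p m o (≤-trans (+-monoʳ-≤ m p≤n) (≤-reflexive m+n≡o+p))) o≤m

toℕ-nextT : ∀ {N′} (t : Fin (suc N′)) → (toℕ (nextT t) ≡ suc (toℕ t)) ⊎ (toℕ (nextT t) ≡ 0 × suc (toℕ t) ≡ suc N′)
toℕ-nextT {N′} t with suc (toℕ t) <? suc N′
... | yes 1+t<N = inj₁ (Finₚ.toℕ-fromℕ< 1+t<N)
... | no 1+t≮N = inj₂ (refl , ≤-antisym (Finₚ.toℕ<n t) (≮⇒≥ 1+t≮N))

prevT : ∀ {N′} → Fin (suc N′) → Fin (suc N′)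
prevT {N′} Fin.zero = Fin.fromℕ N′
prevT (Fin.suc t) = inject₁ t

nextT-prevT : ∀ {N′} (t : Fin (suc N′)) → nextT (prevT t) ≡ t
nextT-prevT {N′} Fin.zero with toℕ-nextT (Fin.fromℕ N′)
... | inj₁ e = ⊥-elim (<-irrefl (trans e (cong suc (Finₚ.toℕ-fromℕ N′))) (Finₚ.toℕ<n (nextT (Fin.fromℕ N′))))
... | inj₂ (e , _) = Finₚ.toℕ-injective e
nextT-prevT (Fin.suc t) with toℕ-nextT (inject₁ t)
... | inj₁ e = Finₚ.toℕ-injective (trans e (cong suc (Finₚ.toℕ-inject₁ t)))
... | inj₂ (_ , e) = ⊥-elim (<-irrefl (trans (cong suc (sym (Finₚ.toℕ-inject₁ t))) e) (Finₚ.toℕ<n (Fin.suc t)))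

-- Orbits and runs

module Orbit {m : ℕ} (k : ℕ) (f₀ : Lab (suc m)) (F₀ : InF k f₀) where

  -- Opaque, since unfolding whirlPow during unification is prohibitively expensive.
  opaque
    lab : ℕ → Lab (suc m)
    lab t = whirlPow k t f₀

    lab-zero : lab 0 ≡ f₀
    lab-zero = refl

    lab-suc : ∀ t → lab (suc t) ≡ whirl k (lab t)
    lab-suc t = refl

    row≡lab : ∀ {N} (t : Fin N) → row k f₀ t ≡ lab (toℕ t)
    row≡lab t = refl

    lab≡whirlPow : ∀ t → lab t ≡ whirlPow k t f₀
    lab≡whirlPow t = refl

  lab-InF : ∀ t → InF k (lab t)
  lab-InF zero = subst (InF k) (sym lab-zero) F₀
  lab-InF (suc t) = subst (InF k) (sym (lab-suc t)) (whirl-InF k {lab t} (lab-InF t))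

  B : ℕ → ℕ
  B t = lab t bot

  B≤k : ∀ t → B t ≤ k
  B≤k t = proj₁ (lab-InF t)

  b≤B : ∀ t i → lab t (b i) ≤ B t
  b≤B t = proj₂ (proj₂ (lab-InF t))

  lab≤k : ∀ t x → lab t x ≤ k
  lab≤k t bot = B≤k t
  lab≤k t (b i) = proj₁ (proj₂ (lab-InF t)) i

  lab-suc-b : ∀ t i → lab (suc t) (b i) ≡ bStep (B t) (lab t (b i))
  lab-suc-b t i = trans (cong (λ g → g (b i)) (lab-suc t)) (whirl-b k {lab t} i (lab-InF t))

  B-suc-< : ∀ {t} → B t < k → B (suc t) ≡ suc (B t)
  B-suc-< {t} B<k = trans (cong (λ g → g bot) (lab-suc t)) (whirl-bot-< k {lab t} (lab-InF t) B<k)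

  lab-shift : ∀ d {s s′} → lab s ≗L lab s′ → lab (d + s) ≗L lab (d + s′)
  lab-shift zero s≗s′ = s≗s′
  lab-shift (suc d) {s} {s′} s≗s′ x = begin
    lab (suc (d + s)) x       ≡⟨ cong (λ g → g x) (lab-suc (d + s)) ⟩
    whirl k (lab (d + s)) x   ≡⟨ whirl-cong k {lab (d + s)} {lab (d + s′)} (lab-shift d s≗s′) x ⟩
    whirl k (lab (d + s′)) x  ≡⟨ cong (λ g → g x) (sym (lab-suc (d + s′))) ⟩
    lab (suc (d + s′)) x      ∎
    where open ≡-Reasoning

  Resets : ℕ → Set
  Resets t = IsBValue (lab t) (B t)

  Resets-cong : ∀ {s s′} → lab s ≗L lab s′ → Resets s → Resets s′
  Resets-cong = bot-IsBValue-cong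

  Resets-after-k : ∀ {t} → B t ≡ k → Resets (suc t)
  Resets-after-k {t} B≡k =
    bot-IsBValue-cong (λ x → cong (λ g → g x) (sym (lab-suc t))) (whirl-bot-k k {lab t} (lab-InF t) B≡k)

  -- While B < k the bottom label climbs by one per step, so the run through t reaches k at
  -- time top t, and the next run starts at next t.
  top : ℕ → ℕ
  top t = t + (k ∸ B t)

  next : ℕ → ℕ
  next t = suc (top t)

  k∸B-suc : ∀ {t} → B t < k → k ∸ B t ≡ suc (k ∸ B (suc t))
  k∸B-suc B<k = trans (+-∸-assoc 1 B<k) (cong (λ v → suc (k ∸ v)) (sym (B-suc-< B<k)))

  top-suc : ∀ {t} → B t < k → top (suc t) ≡ top t
  top-suc {t} B<k = sym (trans (cong (t +_) (k∸B-suc B<k)) (+-suc t _))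

  k∸B≡0 : ∀ {t} → B t ≡ k → k ∸ B t ≡ 0
  k∸B≡0 B≡k = trans (cong (k ∸_) B≡k) (n∸n≡0 k)

  top-k : ∀ {t} → B t ≡ k → top t ≡ t
  top-k {t} B≡k = trans (cong (t +_) (k∸B≡0 B≡k)) (+-identityʳ t)

  next-suc : ∀ {t} → B t < k → next (suc t) ≡ next t
  next-suc B<k = cong suc (top-suc B<k)

  next-k : ∀ {t} → B t ≡ k → next t ≡ suc t
  next-k B≡k = cong suc (top-k B≡k)

  run-ind : ∀ {ℓ} (P : ℕ → Set ℓ) → (∀ t → B t ≡ k → P t) → (∀ t → B t < k → P (suc t) → P t) → ∀ t → P t
  run-ind P at-top climbing t = go (k ∸ B t) t refl
    where
    go : ∀ d t → k ∸ B t ≡ d → P t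
    go d t k∸B≡d with m≤n⇒m<n∨m≡n (B≤k t)
    ... | inj₂ B≡k = at-top t B≡k
    go zero t k∸B≡0 | inj₁ B<k = ⊥-elim (m>n⇒m∸n≢0 B<k k∸B≡0)
    go (suc d) t k∸B≡1+d | inj₁ B<k = climbing t B<k (go d (suc t) (suc-injective (trans (sym (k∸B-suc B<k)) k∸B≡1+d)))

  B-top : ∀ t → B (top t) ≡ k
  B-top = run-ind (λ t → B (top t) ≡ k)
    (λ t B≡k → trans (cong B (top-k B≡k)) B≡k)
    (λ t B<k B-top-suc → trans (cong B (sym (top-suc B<k))) B-top-suc)

  Resets-next : ∀ t → Resets (next t)
  Resets-next t = Resets-after-k (B-top t)

  top-cong : ∀ {s s′} → lab s ≗L lab s′ → lab (top s) ≗L lab (top s′)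
  top-cong {s} {s′} s≗s′ x = begin
    lab (s + d) x            ≡⟨ cong (λ t → lab t x) (+-comm s d) ⟩
    lab (d + s) x            ≡⟨ lab-shift d s≗s′ x ⟩
    lab (d + s′) x           ≡⟨ cong (λ t → lab t x) (+-comm d s′) ⟩
    lab (s′ + d) x           ≡⟨ cong (λ v → lab (s′ + (k ∸ v)) x) (s≗s′ bot) ⟩
    lab (top s′) x           ∎
    where
    open ≡-Reasoning
    d = k ∸ B s

  next-cong : ∀ {s s′} → lab s ≗L lab s′ → lab (next s) ≗L lab (next s′)
  next-cong s≗s′ = lab-shift 1 (top-cong s≗s′)

  runStart : ℕ → ℕ → ℕ
  runStart T₀ zero = T₀
  runStart T₀ (suc j) = next (runStart T₀ j)

  runs-telescope : ∀ T₀ J → rangeSum (λ j → suc (B (runStart T₀ j))) 0 J + runStart T₀ J ≡ J * (k + 2) + T₀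
  runs-telescope T₀ zero = refl
  runs-telescope T₀ (suc J) = begin
    rangeSum β 0 (suc J) + next T                      ≡⟨ cong (_+ next T) (rangeSum-snoc β 0 J) ⟩
    (rangeSum β 0 J + suc (B T)) + suc (T + (k ∸ B T)) ≡⟨ regroup (rangeSum β 0 J) T (B T) (k ∸ B T) ⟩
    (rangeSum β 0 J + T) + (B T + (k ∸ B T) + 2)       ≡⟨ cong₂ (λ u v → u + (v + 2)) (runs-telescope T₀ J) (m+[n∸m]≡n (B≤k T)) ⟩
    (J * (k + 2) + T₀) + (k + 2)                       ≡⟨ shuffle J k T₀ ⟩
    suc J * (k + 2) + T₀                               ∎
    where
    open ≡-Reasoning
    β = λ j → suc (B (runStart T₀ j))
    T = runStart T₀ J
    regroup : ∀ S T β δ → (S + suc β) + suc (T + δ) ≡ (S + T) + (β + δ + 2)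
    regroup = solve-∀
    shuffle : ∀ J k T₀ → (J * (k + 2) + T₀) + (k + 2) ≡ suc J * (k + 2) + T₀
    shuffle = solve-∀

  top-≤-suc : ∀ t → top t ≤ top (suc t)
  top-≤-suc t with m≤n⇒m<n∨m≡n (B≤k t)
  ... | inj₁ B<k = ≤-reflexive (sym (top-suc B<k))
  ... | inj₂ B≡k = ≤-trans (≤-reflexive (top-k B≡k)) (≤-trans (n≤1+n t) (m≤m+n (suc t) _))

  top-<-suc : ∀ {t} → B t ≡ k → top t < top (suc t)
  top-<-suc {t} B≡k = ≤-trans (s≤s (≤-reflexive (top-k B≡k))) (m≤m+n (suc t) _)

  top-mono : ∀ {t t′} → t ≤ t′ → top t ≤ top t′
  top-mono {t} {t′} t≤t′ = subst (λ s → top t ≤ top s) (m∸n+n≡m t≤t′) (go (t′ ∸ t))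
    where
    go : ∀ d → top t ≤ top (d + t)
    go zero = ≤-refl
    go (suc d) = ≤-trans (go d) (top-≤-suc (d + t))

  above-orbit-step : ∀ t {x} → x < B t → above k (lab t) x ≡ above k (lab (suc t)) (suc x) + χ (lab t) (B t)
  above-orbit-step t = above-step {f = lab t} {f′ = lab (suc t)} (b≤B t) (lab-suc-b t) (B≤k t)

  distinct-orbit-step : ∀ t → distinct k (lab (suc t)) ≡ distinct k (lab t)
  distinct-orbit-step t = distinct-step {f = lab t} {f′ = lab (suc t)} (b≤B t) (lab-suc-b t) (B≤k t)

  distinct-orbit : ∀ t → distinct k (lab t) ≡ distinct k f₀
  distinct-orbit zero = cong (distinct k) lab-zero
  distinct-orbit (suc t) = trans (distinct-orbit-step t) (distinct-orbit t)

  b<B-after-climb : ∀ {t} → B t < k → ∀ i → lab (suc t) (b i) < B (suc t)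
  b<B-after-climb {t} B<k i = subst₂ _<_ (sym (lab-suc-b t i)) (sym (B-suc-< B<k)) (s≤s (bStep-≤ (B t) _))

  χ-B-after-climb : ∀ {t} → B t < k → χ (lab (suc t)) (B (suc t)) ≡ 0
  χ-B-after-climb {t} B<k = χ-no (lab (suc t)) λ (i , e) → <-irrefl e (b<B-after-climb B<k i)

  distinct-after-reset : ∀ {t} → Resets t → distinct k (lab t) ≡ suc (above k (lab (suc t)) 0)
  distinct-after-reset {t} resets = begin
    distinct k (lab t)                            ≡⟨ sym (distinct-orbit-step t) ⟩
    χ (lab (suc t)) 0 + above k (lab (suc t)) 0   ≡⟨ cong (_+ above k (lab (suc t)) 0) χ-0≡1 ⟩
    suc (above k (lab (suc t)) 0)                 ∎
    where
    open ≡-Reasoning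
    χ-0≡1 : χ (lab (suc t)) 0 ≡ 1
    χ-0≡1 = trans (χ-step-0 {f = lab t} {f′ = lab (suc t)} (b≤B t) (lab-suc-b t)) (χ-yes (lab t) resets)

  module Tracking (c : Fin (suc m)) where

    y : ℕ → ℕ
    y t = lab t (b c)

    A : ℕ → ℕ
    A t = above k (lab t) (y t)

    y<B-if-A≢0 : ∀ t → A t ≢ 0 → y t < B t
    y<B-if-A≢0 t A≢0 = ≤∧≢⇒< (b≤B t c) λ y≡B →
      A≢0 (above-none k (lab t) (y t) λ i → subst (lab t (b i) ≤_) (sym y≡B) (b≤B t i))

    y-suc-< : ∀ {t} → y t < B t → y (suc t) ≡ suc (y t)
    y-suc-< {t} y<B = trans (lab-suc-b t c) (bStep-< y<B)

    y-suc-reset : ∀ {t} → y t ≡ B t → y (suc t) ≡ 0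
    y-suc-reset {t} y≡B = trans (lab-suc-b t c) (bStep-≮ (<-irrefl y≡B))

    A-suc : ∀ {t} → y t < B t → A (suc t) + χ (lab t) (B t) ≡ A t
    A-suc {t} y<B = trans (cong (λ v → above k (lab (suc t)) v + χ (lab t) (B t)) (y-suc-< y<B))
                          (sym (above-orbit-step t y<B))

    y-next : ∀ t → y (next t) ≡ y (suc t) + (k ∸ B t)
    y-next = run-ind (λ t → y (next t) ≡ y (suc t) + (k ∸ B t))
      (λ t B≡k → trans (cong y (next-k B≡k)) (sym (trans (cong (y (suc t) +_) (k∸B≡0 B≡k)) (+-identityʳ _))))
      climbing
      where
      open ≡-Reasoning
      climbing : ∀ t → B t < k → y (next (suc t)) ≡ y (suc (suc t)) + (k ∸ B (suc t)) → y (next t) ≡ y (suc t) + (k ∸ B t)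
      climbing t B<k ih = begin
        y (next t)                           ≡⟨ cong y (sym (next-suc B<k)) ⟩
        y (next (suc t))                     ≡⟨ ih ⟩
        y (suc (suc t)) + (k ∸ B (suc t))    ≡⟨ cong (_+ (k ∸ B (suc t))) (y-suc-< (b<B-after-climb B<k c)) ⟩
        suc (y (suc t)) + (k ∸ B (suc t))    ≡⟨ sym (+-suc (y (suc t)) _) ⟩
        y (suc t) + suc (k ∸ B (suc t))      ≡⟨ cong (y (suc t) +_) (sym (k∸B-suc B<k)) ⟩
        y (suc t) + (k ∸ B t)                ∎

    A-next : ∀ t → A (next t) ≡ A (suc t)
    A-next = run-ind (λ t → A (next t) ≡ A (suc t))
      (λ t B≡k → cong A (next-k B≡k))
      (λ t B<k ih → trans (cong A (sym (next-suc B<k)))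
        (trans ih (trans (sym (+-identityʳ _)) (trans (cong (A (suc (suc t)) +_) (sym (χ-B-after-climb B<k)))
          (A-suc (b<B-after-climb B<k c))))))

    A-next-resets : ∀ {t} → Resets t → y t < B t → A t ≡ suc (A (next t))
    A-next-resets {t} resets y<B = begin
      A t                            ≡⟨ sym (A-suc y<B) ⟩
      A (suc t) + χ (lab t) (B t)    ≡⟨ cong₂ _+_ (sym (A-next t)) (χ-yes (lab t) resets) ⟩
      A (next t) + 1                 ≡⟨ +-comm _ 1 ⟩
      suc (A (next t))               ∎
      where open ≡-Reasoning

  module Runs {T₀ : ℕ} (resets : Resets T₀) where
    open Tracking (proj₁ resets)

    start : ℕ → ℕ
    start = runStart T₀

    α : ℕ
    α = distinct k (lab T₀)

    -- Since its reset at T₀ the tracked b_c has climbed at every step, and at the start of run j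
    -- only α − j classes of equal b-labels lie above it.
    Invariant : ℕ → Set
    Invariant j = (start j ≡ T₀ + suc (y (start j))) × (A (start j) + j ≡ α)

    y-suc-T₀ : y (suc T₀) ≡ 0
    y-suc-T₀ = y-suc-reset (proj₂ resets)

    α≡1+A : α ≡ suc (A (next T₀))
    α≡1+A = trans (distinct-after-reset resets)
                  (cong suc (sym (trans (A-next T₀) (cong (above k (lab (suc T₀))) y-suc-T₀))))

    invariant-1 : Invariant 1
    invariant-1 = elapsed , trans (+-comm _ 1) (sym α≡1+A)
      where
      elapsed : next T₀ ≡ T₀ + suc (y (next T₀))
      elapsed = trans (sym (+-suc T₀ _))
                      (cong (λ v → T₀ + suc v) (sym (trans (y-next T₀) (cong (_+ (k ∸ B T₀)) y-suc-T₀))))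

    invariant-suc : ∀ j → Invariant (suc j) → suc j < α → Invariant (suc (suc j))
    invariant-suc j (elapsed , remaining) j<α = elapsed′ , remaining′
      where
      T = start (suc j)
      y<B : y T < B T
      y<B = y<B-if-A≢0 T λ A≡0 → <-irrefl (trans (cong (_+ suc j) (sym A≡0)) remaining) j<α
      shift : ∀ a y d → suc ((a + suc y) + d) ≡ a + suc (suc y + d)
      shift = solve-∀
      elapsed′ : next T ≡ T₀ + suc (y (next T))
      elapsed′ = begin
        suc (T + (k ∸ B T))                 ≡⟨ cong (λ s → suc (s + (k ∸ B T))) elapsed ⟩
        suc (T₀ + suc (y T) + (k ∸ B T))    ≡⟨ shift T₀ (y T) (k ∸ B T) ⟩
        T₀ + suc (suc (y T) + (k ∸ B T))    ≡⟨ cong (λ v → T₀ + suc (v + (k ∸ B T))) (sym (y-suc-< y<B)) ⟩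
        T₀ + suc (y (suc T) + (k ∸ B T))    ≡⟨ cong (λ v → T₀ + suc v) (sym (y-next T)) ⟩
        T₀ + suc (y (next T))               ∎
        where open ≡-Reasoning
      remaining′ : A (next T) + suc (suc j) ≡ α
      remaining′ = trans (+-suc _ (suc j))
                         (trans (cong (_+ suc j) (sym (A-next-resets (Resets-next (start j)) y<B))) remaining)

    invariant : ∀ j → suc j ≤ α → Invariant (suc j)
    invariant zero _ = invariant-1
    invariant (suc j) j<α = invariant-suc j (invariant j (<⇒≤ j<α)) j<α

    last-run : start α ≡ T₀ + suc (B (start α))
    last-run = subst (λ a → start a ≡ T₀ + suc (B (start a))) (sym α≡1+A) (ends-at-bottom _ α≡1+A)
      where
      ends-at-bottom : ∀ a → α ≡ suc a → start (suc a) ≡ T₀ + suc (B (start (suc a)))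
      ends-at-bottom a α≡1+a = trans (proj₁ inv) (cong (λ v → T₀ + suc v) y≡B)
        where
        T = start (suc a)
        inv = invariant a (≤-reflexive (sym α≡1+a))
        A≡0 : A T ≡ 0
        A≡0 = +-cancelʳ-≡ (suc a) _ 0 (trans (proj₂ inv) α≡1+a)
        y≡B : y T ≡ B T
        y≡B = ≤-antisym (b≤B T (proj₁ resets)) (≮⇒≥ λ y<B →
          1+n≢0 (trans (sym (A-next-resets (Resets-next (start a)) y<B)) A≡0))

    runs-sum : rangeSum (λ j → suc (B (start j))) 0 (suc α) ≡ α * (k + 2)
    runs-sum = +-cancelʳ-≡ T₀ _ _ (begin
      rangeSum β 0 (suc α) + T₀              ≡⟨ cong (_+ T₀) (rangeSum-snoc β 0 α) ⟩
      rangeSum β 0 α + β α + T₀              ≡⟨ +-assoc (rangeSum β 0 α) (β α) T₀ ⟩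
      rangeSum β 0 α + (β α + T₀)            ≡⟨ cong (rangeSum β 0 α +_) (trans (+-comm (β α) T₀) (sym last-run)) ⟩
      rangeSum β 0 α + start α               ≡⟨ runs-telescope T₀ α ⟩
      α * (k + 2) + T₀                       ∎)
      where
      open ≡-Reasoning
      β = λ j → suc (B (start j))

  -- Whorms

  module Periodic (N′ : ℕ) (period : whirlPow k (suc N′) f₀ ≗L f₀) where

    N : ℕ
    N = suc N′

    lab-N : lab N ≗L lab 0
    lab-N x = trans (cong (λ g → g x) (lab≡whirlPow N)) (trans (period x) (cong (λ g → g x) (sym lab-zero)))

    lab-periodic : ∀ t → lab (N + t) ≗L lab t
    lab-periodic t x = begin
      lab (N + t) x  ≡⟨ cong (λ s → lab s x) (+-comm N t) ⟩
      lab (t + N) x  ≡⟨ lab-shift t lab-N x ⟩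
      lab (t + 0) x  ≡⟨ cong (λ s → lab s x) (+-identityʳ t) ⟩
      lab t x        ∎
      where open ≡-Reasoning

    top-periodic : ∀ t → top (N + t) ≡ N + top t
    top-periodic t = trans (cong (λ v → N + t + (k ∸ v)) (lab-periodic t bot)) (+-assoc N t _)

    row-bot : ∀ (t : Fin N) → row k f₀ t bot ≡ B (toℕ t)
    row-bot t = cong (λ g → g bot) (row≡lab t)

    row-nextT : ∀ (t : Fin N) → row k f₀ (nextT t) ≗L lab (suc (toℕ t))
    row-nextT t x with toℕ-nextT t
    ... | inj₁ e = trans (cong (λ g → g x) (row≡lab (nextT t))) (cong (λ s → lab s x) e)
    ... | inj₂ (e₀ , e₁) = begin
      row k f₀ (nextT t) x    ≡⟨ cong (λ g → g x) (row≡lab (nextT t)) ⟩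
      lab (toℕ (nextT t)) x   ≡⟨ cong (λ s → lab s x) e₀ ⟩
      lab 0 x                 ≡⟨ sym (lab-N x) ⟩
      lab N x                 ≡⟨ cong (λ s → lab s x) (sym e₁) ⟩
      lab (suc (toℕ t)) x     ∎
      where open ≡-Reasoning

    lab-prevT : ∀ t → lab (suc (toℕ (prevT t))) ≗L lab (toℕ t)
    lab-prevT t x = begin
      lab (suc (toℕ (prevT t))) x   ≡⟨ sym (row-nextT (prevT t) x) ⟩
      row k f₀ (nextT (prevT t)) x  ≡⟨ cong (λ s → row k f₀ s x) (nextT-prevT t) ⟩
      row k f₀ t x                  ≡⟨ cong (λ g → g x) (row≡lab t) ⟩
      lab (toℕ t) x                 ∎
      where open ≡-Reasoning

    -- Constant on whorms: a whirl-successive step in time raises t and the label together.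
    phase : WE (suc m) N → ℕ
    phase (x , t) = (toℕ t + (k ∸ row k f₀ t x)) % N

    phase-bot : ∀ t → phase (bot , t) ≡ top (toℕ t) % N
    phase-bot t = cong (λ v → (toℕ t + (k ∸ v)) % N) (row-bot t)

    phase-nextT : ∀ x t → phase (x , nextT t) ≡ (suc (toℕ t) + (k ∸ lab (suc (toℕ t)) x)) % N
    phase-nextT x t = trans (index≡ (toℕ-nextT t)) (cong (λ v → (suc (toℕ t) + (k ∸ v)) % N) (row-nextT t x))
      where
      d = k ∸ row k f₀ (nextT t) x
      index≡ : (toℕ (nextT t) ≡ suc (toℕ t)) ⊎ (toℕ (nextT t) ≡ 0 × suc (toℕ t) ≡ N) →
               (toℕ (nextT t) + d) % N ≡ (suc (toℕ t) + d) % N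
      index≡ (inj₁ e) = cong (λ s → (s + d) % N) e
      index≡ (inj₂ (e₀ , e₁)) = begin
        (toℕ (nextT t) + d) % N  ≡⟨ cong (λ s → (s + d) % N) e₀ ⟩
        d % N                    ≡⟨ sym ([m+n]%n≡m%n d N) ⟩
        (d + N) % N              ≡⟨ cong (_% N) (+-comm d N) ⟩
        (N + d) % N              ≡⟨ cong (λ s → (s + d) % N) (sym e₁) ⟩
        (suc (toℕ t) + d) % N    ∎
        where open ≡-Reasoning

    phase-Succ : ∀ {e e′} → Succ k f₀ e e′ → phase e ≡ phase e′
    phase-Succ (cover x y t _ eq) = cong (λ v → (toℕ t + (k ∸ v)) % N) eq
    phase-Succ (step x t eq) = sym (begin
      phase (x , nextT t)                           ≡⟨ phase-nextT x t ⟩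
      (suc (toℕ t) + (k ∸ lab (suc (toℕ t)) x)) % N ≡⟨ cong (λ v → (suc (toℕ t) + (k ∸ v)) % N) next≡ ⟩
      (suc (toℕ t) + (k ∸ suc r)) % N               ≡⟨ cong (_% N) (sym (+-suc (toℕ t) _)) ⟩
      (toℕ t + suc (k ∸ suc r)) % N                 ≡⟨ cong (λ v → (toℕ t + v) % N) (sym (+-∸-assoc 1 r<k)) ⟩
      phase (x , t)                                 ∎)
      where
      open ≡-Reasoning
      r = row k f₀ t x
      next≡ : lab (suc (toℕ t)) x ≡ suc r
      next≡ = trans (sym (row-nextT t x)) (trans eq (+-comm r 1))
      r<k : r < k
      r<k = subst (_≤ k) next≡ (lab≤k (suc (toℕ t)) x)

    phase-SameWhorm : ∀ {e e′} → SameWhorm k f₀ e e′ → phase e ≡ phase e′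
    phase-SameWhorm ε = refl
    phase-SameWhorm (fwd s ◅ rest) = trans (phase-Succ s) (phase-SameWhorm rest)
    phase-SameWhorm (bwd s ◅ rest) = trans (sym (phase-Succ s)) (phase-SameWhorm rest)

    top-within-period : ∀ {T s} → B T ≡ k → s ≤ N + T → top s < top (suc T) + N
    top-within-period {T} {s} B≡k s≤N+T = begin-strict
      top s                ≤⟨ top-mono s≤N+T ⟩
      top (N + T)          <⟨ top-<-suc (trans (lab-periodic T bot) B≡k) ⟩
      top (suc (N + T))    ≡⟨ cong top (sym (+-suc N T)) ⟩
      top (N + suc T)      ≡⟨ top-periodic (suc T) ⟩
      N + top (suc T)      ≡⟨ +-comm N _ ⟩
      top (suc T) + N      ∎
      where open ≤-Reasoning

    same-phase-in-run : ∀ {T s} → B T ≡ k → suc T ≤ N → s < N → top s % N ≡ top (suc T) % N →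
      ∃[ s′ ] (lab s′ ≗L lab s) × (suc T ≤ s′) × (top s′ ≡ top (suc T))
    same-phase-in-run {T} {s} B≡k 1+T≤N s<N same-phase = lift (suc T ≤? s)
      where
      lift : Dec (suc T ≤ s) → ∃[ s′ ] (lab s′ ≗L lab s) × (suc T ≤ s′) × (top s′ ≡ top (suc T))
      lift (yes 1+T≤s) = s , (λ _ → refl) , 1+T≤s ,
        %-injective-window N (top-mono 1+T≤s) (top-within-period B≡k (≤-trans (<⇒≤ s<N) (m≤m+n N T))) same-phase
      lift (no 1+T≰s) = N + s , lab-periodic s , ≤-trans 1+T≤N (m≤m+n N s) ,
        %-injective-window N (top-mono (≤-trans 1+T≤N (m≤m+n N s)))
          (top-within-period B≡k (+-monoʳ-≤ N (s≤s⁻¹ (≰⇒> 1+T≰s))))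
          (trans (cong (_% N) (trans (top-periodic s) (+-comm N (top s)))) (trans ([m+n]%n≡m%n (top s) N) same-phase))

    BottomMin : WE (suc m) N → Fin N → Set
    BottomMin ξ t = SameWhorm k f₀ (bot , t) ξ × (∀ t′ → SameWhorm k f₀ (bot , t′) ξ → B (toℕ t) ≤ B (toℕ t′))

    IsTval⇒BottomMin : ∀ {ξ τ} → IsTval k f₀ ξ τ → ∃[ t ] BottomMin ξ t × (τ ≡ suc (B (toℕ t)))
    IsTval⇒BottomMin (μ , τ≡1+μ , (t , t∈ξ , row≡μ) , minimal) =
      t , (t∈ξ , λ t′ t′∈ξ → subst₂ _≤_ (sym B≡μ) (row-bot t′) (minimal t′ t′∈ξ)) , trans τ≡1+μ (cong suc (sym B≡μ))
      where
      B≡μ : B (toℕ t) ≡ μ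
      B≡μ = trans (sym (row-bot t)) row≡μ

    before-bottomMin : ∀ {ξ t} → BottomMin ξ t → B (toℕ (prevT t)) ≡ k
    before-bottomMin {ξ} {t} (t∈ξ , minimal) with m≤n⇒m<n∨m≡n (B≤k (toℕ (prevT t)))
    ... | inj₂ B≡k = B≡k
    ... | inj₁ B<k = ⊥-elim (<⇒≱ B<B (minimal p p∈ξ))
      where
      p = prevT t
      B<B : B (toℕ p) < B (toℕ t)
      B<B = subst (B (toℕ p) <_) (trans (sym (B-suc-< B<k)) (lab-prevT t bot)) ≤-refl
      climbs : row k f₀ (nextT p) bot ≡ row k f₀ p bot + 1
      climbs = trans (row-nextT p bot) (trans (B-suc-< B<k) (trans (cong suc (sym (row-bot p))) (+-comm 1 _)))
      p∈ξ : SameWhorm k f₀ (bot , p) ξ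
      p∈ξ = fwd (step bot p climbs) ◅ subst (λ s → SameWhorm k f₀ (bot , s) ξ) (sym (nextT-prevT t)) t∈ξ

    bottomMin-Resets : ∀ {ξ t} → BottomMin ξ t → Resets (toℕ t)
    bottomMin-Resets {t = t} bm = Resets-cong (lab-prevT t) (Resets-after-k (before-bottomMin bm))

    same-phase : ∀ {ξ t t′} → SameWhorm k f₀ (bot , t) ξ → SameWhorm k f₀ (bot , t′) ξ → top (toℕ t) % N ≡ top (toℕ t′) % N
    same-phase {t = t} {t′} t∈ξ t′∈ξ =
      trans (sym (phase-bot t)) (trans (phase-SameWhorm t∈ξ) (trans (sym (phase-SameWhorm t′∈ξ)) (phase-bot t′)))

    top-of-bottomMin : ∀ {ξ t t′} → BottomMin ξ t → SameWhorm k f₀ (bot , t′) ξ → B (toℕ t′) ≡ k →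
      lab (top (toℕ t)) ≗L lab (toℕ t′)
    top-of-bottomMin {ξ} {t} {t′} bm t′∈ξ B≡k x = begin
      lab (top (toℕ t)) x   ≡⟨ top-cong (λ z → sym (lab-prevT t z)) x ⟩
      lab (top R) x         ≡⟨ cong (λ s → lab s x) (sym s′≡top) ⟩
      lab s′ x              ≡⟨ proj₁ (proj₂ run) x ⟩
      lab (toℕ t′) x        ∎
      where
      open ≡-Reasoning
      R = suc (toℕ (prevT t))
      phase≡ : top (toℕ t′) % N ≡ top R % N
      phase≡ = begin
        top (toℕ t′) % N              ≡⟨ same-phase t′∈ξ (proj₁ bm) ⟩
        top (toℕ t) % N               ≡⟨ sym (phase-bot t) ⟩
        phase (bot , t)               ≡⟨ cong (λ s → phase (bot , s)) (sym (nextT-prevT t)) ⟩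
        phase (bot , nextT (prevT t)) ≡⟨ phase-nextT bot (prevT t) ⟩
        top R % N                     ∎
      run = same-phase-in-run (before-bottomMin bm) (Finₚ.toℕ<n (prevT t)) (Finₚ.toℕ<n t′) phase≡
      s′ = proj₁ run
      s′≡top : s′ ≡ top R
      s′≡top = trans (sym (top-k (trans (proj₁ (proj₂ run) bot) B≡k))) (proj₂ (proj₂ (proj₂ run)))

    bottomMin-after-top : ∀ {ξ t t′} → BottomMin ξ t → SameWhorm k f₀ (bot , nextT t′) ξ → B (toℕ t′) ≡ k →
      lab (suc (toℕ t′)) ≗L lab (toℕ t)
    bottomMin-after-top {ξ} {t} {t′} (t∈ξ , minimal) t′⁺∈ξ B≡k x =
      trans (cong (λ v → lab v x) (sym s≡R)) (proj₁ (proj₂ run) x)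
      where
      R = suc (toℕ t′)
      phase≡ : top (toℕ t) % N ≡ top R % N
      phase≡ = trans (same-phase t∈ξ t′⁺∈ξ) (trans (sym (phase-bot (nextT t′))) (phase-nextT bot t′))
      run = same-phase-in-run B≡k (Finₚ.toℕ<n t′) (Finₚ.toℕ<n t) phase≡
      s = proj₁ run
      B-s≤B-R : B s ≤ B R
      B-s≤B-R = subst₂ _≤_ (sym (proj₁ (proj₂ run) bot)) (trans (sym (row-bot (nextT t′))) (row-nextT t′ bot))
                  (minimal (nextT t′) t′⁺∈ξ)
      -- top is constant on the run starting at R, so R ≤ s and B s ≤ B R leave only s = R.
      s≡R : s ≡ R
      s≡R = +-≡-≤-≤ (proj₂ (proj₂ (proj₂ run))) (proj₁ (proj₂ (proj₂ run))) (∸-monoʳ-≤ k B-s≤B-R)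

    front-bottomMin : ∀ {ξ ξ′ t t′} → BottomMin ξ t → BottomMin ξ′ t′ → InFront k f₀ ξ′ ξ → lab (next (toℕ t)) ≗L lab (toℕ t′)
    front-bottomMin bm bm′ (s , s∈ξ , row≡k , s⁺∈ξ′) x =
      trans (lab-shift 1 (top-of-bottomMin bm s∈ξ B≡k) x) (bottomMin-after-top bm′ s⁺∈ξ′ B≡k x)
      where
      B≡k = trans (sym (row-bot s)) row≡k

    consecutive-bottomMins : ∀ {a} (ξ : Fin (suc a) → WE (suc m) N) (t : Fin (suc a) → Fin N) →
      (∀ i → BottomMin (ξ i) (t i)) → (∀ i → InFront k f₀ (ξ (Fin.suc i)) (ξ (inject₁ i))) →
      ∀ i → lab (runStart (toℕ (t Fin.zero)) (toℕ i)) ≗L lab (toℕ (t i))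
    consecutive-bottomMins ξ t bm front = <-weakInduction P (λ _ → refl) P-suc
      where
      P : Fin _ → Set
      P i = lab (runStart (toℕ (t Fin.zero)) (toℕ i)) ≗L lab (toℕ (t i))
      P-suc : ∀ i → P (inject₁ i) → P (Fin.suc i)
      P-suc i ih x = trans (next-cong ih′ x) (front-bottomMin (bm (inject₁ i)) (bm (Fin.suc i)) (front i) x)
        where
        ih′ : lab (runStart (toℕ (t Fin.zero)) (toℕ i)) ≗L lab (toℕ (t (inject₁ i)))
        ih′ z = trans (cong (λ j → lab (runStart (toℕ (t Fin.zero)) j) z) (sym (Finₚ.toℕ-inject₁ i))) (ih z)

lemma4p6 : (n k : ℕ) → 1 ≤ n → 1 ≤ k →
    (f0 : Lab n) → InF k f0 →
    (N : ℕ) → IsOrbitSize k f0 N →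
    (ξ : Fin (suc (alpha f0)) → WE n N) →
    ((i : Fin (alpha f0)) → InFront k f0 (ξ (Fin.suc i)) (ξ (inject₁ i))) →
    (τ : Fin (suc (alpha f0)) → ℕ) →
    ((i : Fin (suc (alpha f0))) → IsTval k f0 (ξ i) (τ i)) →
    sum (tabulate τ) ≡ alpha f0 * (k + 2)
lemma4p6 (suc m) k _ _ f₀ F₀ (suc N′) (_ , period , _) ξ front τ isTval = begin
  sum (tabulate τ)               ≡⟨ sum-tabulate τ β 0 τ≡ ⟩
  rangeSum β 0 (suc (alpha f₀))  ≡⟨ cong (λ a → rangeSum β 0 (suc a)) alpha≡α ⟩
  rangeSum β 0 (suc α)           ≡⟨ runs-sum ⟩
  α * (k + 2)                    ≡⟨ cong (_* (k + 2)) (sym alpha≡α) ⟩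
  alpha f₀ * (k + 2)             ∎
  where
  open ≡-Reasoning
  open Orbit k f₀ F₀
  open Periodic N′ period
  t : Fin (suc (alpha f₀)) → Fin (suc N′)
  t i = proj₁ (IsTval⇒BottomMin (isTval i))
  bm : ∀ i → BottomMin (ξ i) (t i)
  bm i = proj₁ (proj₂ (IsTval⇒BottomMin (isTval i)))
  open Runs (bottomMin-Resets (bm Fin.zero))
  β : ℕ → ℕ
  β j = suc (B (start j))
  τ≡ : ∀ i → τ i ≡ β (0 + toℕ i)
  τ≡ i = trans (proj₂ (proj₂ (IsTval⇒BottomMin (isTval i))))
               (cong suc (sym (consecutive-bottomMins ξ t bm front i bot)))
  alpha≡α : alpha f₀ ≡ α
  alpha≡α = trans (alpha≡distinct k f₀ (proj₁ (proj₂ F₀))) (sym (distinct-orbit _))
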